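{- Let $F=\coprod_{i\in I}\hom(X_i,-):\mathbf{Set}\to\mathbf{Set}$ for a non-empty family of sets $(X_i)_{i\in I}$, and let $\alpha^s:F\times F\to F$ be the natural transformation corresponding to an element $s=(s_{ij})_{i,j\in I}\in\prod_{i,j\in I}F(X_i+X_j)$. Then $\alpha^s$ is idempotent if and only if for each $i\in I$, $s_{ii}\in F(X_i+X_i)$ is a map $s_{ii}:X_i\to X_i+X_i$ (lying in the $i$-th summand) such that $\triangledown\circ s_{ii}=\mathrm{id}_{X_i}$, where $\triangledown:X_i+X_i\to X_i$ is the codiagonal map.
   Context: An element $s_{ij}\in F(X_i+X_j)$ is a pair consisting of an index $k\in I$ and a map $X_k\to X_i+X_j$. The natural transformation $\alpha^s$ is defined at each set $Y$ by $\alpha^s_Y(a,b)=F[a,b](s_{ij})$ for $(a,b)\in\hom(X_i,Y)\times\hom(X_j,Y)$, where $[a,b]$ is the copairing; every natural transformation $F\times F\to F$ is of this form for a unique $s$. A natural transformation $\alpha:F\times F\to F$ is idempotent if for every set $X$ and every map $a:X\to FX$, $\alpha_X\circ\langle a,a\rangle=a$. -}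

module Defs where

open import Data.Product using (Σ; Σ-syntax; _,_; _×_; proj₁; proj₂)
open import Data.Sum using (_⊎_; [_,_])
open import Function using (id; _∘_)
open import Relation.Binary.PropositionalEquality using (_≡_; subst)

F : {I : Set} → (I → Set) → Set → Set
F {I} X Y = Σ[ k ∈ I ] (X k → Y)

Fmap : {I : Set} (X : I → Set) {Y Z : Set} → (Y → Z) → F X Y → F X Z
Fmap X h (k , f) = (k , h ∘ f)

-- This is the
-- (extensional) equality of elements of the coproduct of hom-sets.
_≈F_ : {I : Set} {X : I → Set} {Y : Set} → F X Y → F X Y → Set
_≈F_ {X = X} (k , f) (k' , f') =
  Σ[ p ∈ k ≡ k' ] (∀ x → f x ≡ f' (subst X p x))

Elem : {I : Set} → (I → Set) → Set
Elem {I} X = (i j : I) → F X (X i ⊎ X j)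

α : {I : Set} {X : I → Set} → Elem X → (Y : Set) → F X Y → F X Y → F X Y
α {X = X} s Y (i , a) (j , b) = Fmap X [ a , b ] (s i j)

Idempotent : {I : Set} {X : I → Set} → Elem X → Set₁
Idempotent {X = X} s =
  (Y : Set) (a : Y → F X Y) (y : Y) → α s Y (a y) (a y) ≈F a y

codiag : {A : Set} → A ⊎ A → A
codiag = [ id , id ]

Condition : {I : Set} {X : I → Set} → Elem X → Set
Condition {I} {X} s =
  (i : I) → Σ[ g ∈ (X i → X i ⊎ X i) ]
    (s i i ≈F (i , g)) × ((x : X i) → codiag (g x) ≡ x)

module Submission where

open import Defs
open import Data.Product using (Σ-syntax; _,_; _×_)
open import Data.Sum using (_⊎_; [_,_]; inj₁; inj₂)
open import Data.Sum.Properties using ([,]-∘; inj₂-injective)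
open import Data.Unit using (⊤; tt)
open import Function.Bundles using (_⇔_; mk⇔)
open import Relation.Binary.PropositionalEquality using (_≡_; refl; cong; sym; module ≡-Reasoning)

-- Since α s Y (i , b) (i , b) = F[b , b](s_ii) and [b , b] = b ∘ ∇, the condition
-- makes this (i , b).  Conversely, testing idempotence on Y = ⊤ + X_i with the
-- constant map a = (i , inj₂) forces inj₂ ∘ ∇ ∘ s_ii = inj₂, hence ∇ ∘ s_ii = id;
-- the point of ⊤ makes Y inhabited even when X_i is empty.

module _ {I : Set} {X : I → Set} {i : I} where

  fold-≈-of-codiag-section : {Y : Set} (b : X i → Y) (t : F X (X i ⊎ X i))
    (g : X i → X i ⊎ X i) → t ≈F (i , g) → ((x : X i) → codiag (g x) ≡ x) →
    Fmap X [ b , b ] t ≈F (i , b)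
  fold-≈-of-codiag-section b (.i , f) g (refl , f≗g) ∇g≗id = refl , λ x → begin
    [ b , b ] (f x)     ≡⟨ cong [ b , b ] (f≗g x) ⟩
    [ b , b ] (g x)     ≡⟨ sym ([,]-∘ b (g x)) ⟩
    b (codiag (g x))    ≡⟨ cong b (∇g≗id x) ⟩
    b x                 ∎
    where open ≡-Reasoning

  codiag-section-of-fold-inj₂-≈ : (t : F X (X i ⊎ X i)) →
    Fmap X [ inj₂ {A = ⊤} , inj₂ ] t ≈F (i , inj₂) →
    Σ[ g ∈ (X i → X i ⊎ X i) ] (t ≈F (i , g)) × ((x : X i) → codiag (g x) ≡ x)
  codiag-section-of-fold-inj₂-≈ (.i , f) (refl , fold≗inj₂) =
    f , (refl , λ _ → refl) , λ x → inj₂-injective (begin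
      inj₂ (codiag (f x))   ≡⟨ [,]-∘ inj₂ (f x) ⟩
      [ inj₂ , inj₂ ] (f x) ≡⟨ fold≗inj₂ x ⟩
      inj₂ x                ∎)
    where open ≡-Reasoning

proposition5p3 : (I : Set) (X : I → Set) (nonempty : I) (s : Elem X) →
    Idempotent s ⇔ Condition s
proposition5p3 I X _ s = mk⇔ idempotent⇒condition condition⇒idempotent
  where
  idempotent⇒condition : Idempotent s → Condition s
  idempotent⇒condition idem i = codiag-section-of-fold-inj₂-≈ (s i i)
    (idem (⊤ ⊎ X i) (λ _ → i , inj₂) (inj₁ tt))

  condition⇒idempotent : Condition s → Idempotent s
  condition⇒idempotent cond Y a y with a y
  ... | (i , b) with cond i
  ...   | (g , sᵢᵢ≈g , ∇g≗id) = fold-≈-of-codiag-section b (s i i) g sᵢᵢ≈g ∇g≗id
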